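{- If $n\equiv1\pmod4$, then $\beta_n,\delta_n\in V_1$ and $\alpha_n,\gamma_n\in V_3$. If $n\equiv3\pmod4$, then $\alpha_n,\gamma_n\in V_1$ and $\beta_n,\delta_n\in V_3$.
   Context: Let $\alpha_n,\beta_n,\gamma_n,\delta_n\in V=t\,\mathbb{Z}/2[t^2]$ ($n>0$ odd) all satisfy $A_{n+8}=t^8A_n+t^2A_{n+2}$, with initial values $\alpha_1,\alpha_3,\alpha_5,\alpha_7=0,t,0,t^5$; $\beta_1,\beta_3,\beta_5,\beta_7=t,t^3,t^5,t^7+t^3$; $\gamma_1,\gamma_3,\gamma_5,\gamma_7=0,0,t^3,t^5$; $\delta_1,\delta_3,\delta_5,\delta_7=0,0,0,t^3$. $V_1$ (resp. $V_3$) is the $\mathbb{Z}/2$-span of the $t^m$ with $m\equiv1\pmod4$ (resp. $m\equiv3\pmod4$). -}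

module Defs where

open import Data.Bool using (Bool; true; false; _xor_)
open import Data.List using (List; []; _∷_; replicate; _++_)
open import Data.Nat using (ℕ; zero; suc; _%_)
open import Relation.Binary.PropositionalEquality using (_≡_)

-- Polynomials over ℤ/2 in t, as coefficient lists: the i-th entry is the
-- coefficient of t^i (missing entries are 0).
Poly : Set
Poly = List Bool

coeff : Poly → ℕ → Bool
coeff []       _       = false
coeff (b ∷ _)  zero    = b
coeff (_ ∷ p)  (suc m) = coeff p m

_⊕_ : Poly → Poly → Poly
[]      ⊕ q       = q
(a ∷ p) ⊕ []      = a ∷ p
(a ∷ p) ⊕ (b ∷ q) = (a xor b) ∷ (p ⊕ q)

shift : ℕ → Poly → Poly
shift k p = replicate k false ++ p

mono : ℕ → Poly
mono k = shift k (true ∷ [])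

-- A sequence A_n (n odd) indexed by k with n = 2k+1, determined by its
-- values at n = 1,3,5,7 and the recurrence A_{n+8} = t^8 A_n + t^2 A_{n+2}.
rec : Poly → Poly → Poly → Poly → ℕ → Poly
rec a1 a3 a5 a7 zero                      = a1
rec a1 a3 a5 a7 (suc zero)                = a3
rec a1 a3 a5 a7 (suc (suc zero))          = a5
rec a1 a3 a5 a7 (suc (suc (suc zero)))    = a7
rec a1 a3 a5 a7 (suc (suc (suc (suc k)))) =
  shift 8 (rec a1 a3 a5 a7 k) ⊕ shift 2 (rec a1 a3 a5 a7 (suc k))

α β γ δ : ℕ → Poly
α = rec [] (mono 1) [] (mono 5)
β = rec (mono 1) (mono 3) (mono 5) (mono 7 ⊕ mono 3)
γ = rec [] [] (mono 3) (mono 5)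
δ = rec [] [] [] (mono 3)

Odd : ℕ → Set
Odd n = n % 2 ≡ 1

open import Data.Nat using (_/_)

αₙ βₙ γₙ δₙ : ℕ → Poly
αₙ n = α (n / 2)
βₙ n = β (n / 2)
γₙ n = γ (n / 2)
δₙ n = δ (n / 2)

-- V_r : span of t^m with m ≡ r (mod 4)
InV : ℕ → Poly → Set
InV r p = ∀ m → coeff p m ≡ true → m % 4 ≡ r

V₁ V₃ : Poly → Set
V₁ = InV 1
V₃ = InV 3

-- Multiplication by t^k moves V_r into V_{(r + k) mod 4}: t^8 preserves each V_r and t^2
-- swaps V_1 and V_3. Hence the recurrence A_{n+8} = t^8 A_n + t^2 A_{n+2} propagates the
-- invariant "A_n ∈ V_{(n + c) mod 4}" from any four consecutive odd indices to the next one,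
-- and the initial values satisfy it with c = 0 for β, δ and with c = 2 for α, γ.
module Submission where

open import Data.Bool using (true; false; _xor_)
open import Data.List using ([]; _∷_)
open import Data.Nat using (ℕ; zero; suc; _+_; _*_; _%_; _/_)
open import Data.Nat.DivMod using (%-distribˡ-+; m≡m%n+[m/n]*n; m∣n⇒o%n%m≡o%m)
open import Data.Nat.Divisibility using (divides)
open import Data.Nat.Tactic.RingSolver using (solve-∀)
open import Data.Product using (_×_; _,_; proj₁; ∃-syntax)
open import Data.Sum using (_⊎_; inj₁; inj₂)
open import Relation.Binary.PropositionalEquality
  using (_≡_; refl; sym; trans; cong; subst; module ≡-Reasoning)

open import Defs

xor≡true : ∀ a b → a xor b ≡ true → a ≡ true ⊎ b ≡ true
xor≡true true  _ _ = inj₁ refl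
xor≡true false _ e = inj₂ e

coeff-⊕ : ∀ p q m → coeff (p ⊕ q) m ≡ true → coeff p m ≡ true ⊎ coeff q m ≡ true
coeff-⊕ []      _       _       e = inj₂ e
coeff-⊕ (_ ∷ _) []      _       e = inj₁ e
coeff-⊕ (a ∷ _) (b ∷ _) zero    e = xor≡true a b e
coeff-⊕ (_ ∷ p) (_ ∷ q) (suc m) e = coeff-⊕ p q m e

coeff-shift : ∀ k p m → coeff (shift k p) m ≡ true → ∃[ j ] (m ≡ k + j × coeff p j ≡ true)
coeff-shift zero    _ m       e = m , refl , e
coeff-shift (suc k) p (suc m) e with coeff-shift k p m e
... | j , refl , eⱼ = j , refl , eⱼ

coeff-mono : ∀ k m → coeff (mono k) m ≡ true → m ≡ k
coeff-mono zero    zero    _ = refl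
coeff-mono (suc k) (suc m) e = cong suc (coeff-mono k m e)

InV-[] : ∀ r → InV r []
InV-[] _ _ ()

InV-⊕ : ∀ {r} p q → InV r p → InV r q → InV r (p ⊕ q)
InV-⊕ p q hp hq m e with coeff-⊕ p q m e
... | inj₁ e₁ = hp m e₁
... | inj₂ e₂ = hq m e₂

InV-mono : ∀ k → InV (k % 4) (mono k)
InV-mono k m e = cong (_% 4) (coeff-mono k m e)

InV-shift : ∀ k {m p} → InV (m % 4) p → InV ((k + m) % 4) (shift k p)
InV-shift k {m} {p} h _ e with coeff-shift k p _ e
... | j , refl , eⱼ = begin
  (k + j) % 4           ≡⟨ %-distribˡ-+ k j 4 ⟩
  (k % 4 + j % 4) % 4   ≡⟨ cong (λ x → (k % 4 + x) % 4) (h j eⱼ) ⟩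
  (k % 4 + m % 4) % 4   ≡⟨ %-distribˡ-+ k m 4 ⟨
  (k + m) % 4           ∎
  where open ≡-Reasoning

module _ {a₁ a₃ a₅ a₇ : Poly} (c : ℕ) where

  private
    A : ℕ → Poly
    A = rec a₁ a₃ a₅ a₇

  HasResidue : ℕ → Set
  HasResidue k = InV ((2 * k + c) % 4) (A k)

  residue-step : ∀ k → HasResidue k → HasResidue (suc k) → HasResidue (4 + k)
  residue-step k hₖ hₖ₊₁ = InV-⊕ (shift 8 (A k)) (shift 2 (A (suc k)))
    (subst (λ r → InV r (shift 8 (A k))) (cong (_% 4) (via-t⁸ k c))
           (InV-shift 8 {2 * k + c} hₖ))
    (subst (λ r → InV r (shift 2 (A (suc k)))) (cong (_% 4) (via-t² k c))
           (InV-shift 2 {2 * suc k + c} hₖ₊₁))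
    where
    via-t⁸ : ∀ k c → 8 + (2 * k + c) ≡ 2 * (4 + k) + c
    via-t⁸ = solve-∀
    -- (4 + x) % 4 reduces to x % 4, so the extra 4 on the left is invisible modulo 4
    via-t² : ∀ k c → 4 + (2 + (2 * suc k + c)) ≡ 2 * (4 + k) + c
    via-t² = solve-∀

  rec-residue : HasResidue 0 → HasResidue 1 → HasResidue 2 → HasResidue 3 → ∀ k → HasResidue k
  rec-residue h₀ h₁ h₂ h₃ k = proj₁ (window k)
    where
    window : ∀ k → HasResidue k × HasResidue (1 + k) × HasResidue (2 + k) × HasResidue (3 + k)
    window zero    = h₀ , h₁ , h₂ , h₃
    window (suc k) with window k
    ... | hₖ , hₖ₊₁ , hₖ₊₂ , hₖ₊₃ = hₖ₊₁ , hₖ₊₂ , hₖ₊₃ , residue-step k hₖ hₖ₊₁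

β-residue : ∀ k → InV ((2 * k + 1) % 4) (β k)
β-residue = rec-residue 1
  (InV-mono 1) (InV-mono 3) (InV-mono 5) (InV-⊕ (mono 7) (mono 3) (InV-mono 7) (InV-mono 3))

δ-residue : ∀ k → InV ((2 * k + 1) % 4) (δ k)
δ-residue = rec-residue 1 (InV-[] 1) (InV-[] 3) (InV-[] 1) (InV-mono 3)

α-residue : ∀ k → InV ((2 * k + 3) % 4) (α k)
α-residue = rec-residue 3 (InV-[] 3) (InV-mono 1) (InV-[] 3) (InV-mono 5)

γ-residue : ∀ k → InV ((2 * k + 3) % 4) (γ k)
γ-residue = rec-residue 3 (InV-[] 3) (InV-[] 1) (InV-mono 3) (InV-mono 5)

odd-half-residue : ∀ n c → Odd n → (2 * (n / 2) + suc c) % 4 ≡ (n % 4 + c % 4) % 4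
odd-half-residue n c odd = begin
  (2 * (n / 2) + suc c) % 4      ≡⟨ cong (_% 4) (reassoc (n / 2) c) ⟩
  (1 + n / 2 * 2 + c) % 4        ≡⟨ cong (λ m → (m + c) % 4) n≡1+[n/2]*2 ⟨
  (n + c) % 4                    ≡⟨ %-distribˡ-+ n c 4 ⟩
  (n % 4 + c % 4) % 4            ∎
  where
  open ≡-Reasoning
  reassoc : ∀ h c → 2 * h + suc c ≡ 1 + h * 2 + c
  reassoc = solve-∀
  n≡1+[n/2]*2 : n ≡ 1 + n / 2 * 2
  n≡1+[n/2]*2 = trans (m≡m%n+[m/n]*n n 2) (cong (_+ n / 2 * 2) odd)

InV-at-odd : ∀ (A : ℕ → Poly) c → (∀ k → InV ((2 * k + suc c) % 4) (A k)) →
             ∀ n {r} → n % 4 ≡ r → r % 2 ≡ 1 → InV ((r + c % 4) % 4) (A (n / 2))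
InV-at-odd A c h n refl odd =
  subst (λ r → InV r (A (n / 2))) (odd-half-residue n c (trans (sym n%4%2≡n%2) odd)) (h (n / 2))
  where
  n%4%2≡n%2 : n % 4 % 2 ≡ n % 2
  n%4%2≡n%2 = m∣n⇒o%n%m≡o%m 2 4 n (divides 2 refl)

lemma6p7 : ∀ (n : ℕ) →
    (n % 4 ≡ 1 → V₁ (βₙ n) × V₁ (δₙ n) × V₃ (αₙ n) × V₃ (γₙ n)) ×
    (n % 4 ≡ 3 → V₁ (αₙ n) × V₁ (γₙ n) × V₃ (βₙ n) × V₃ (δₙ n))
lemma6p7 n =
  (λ n≡1 → at β 0 β-residue n≡1 refl , at δ 0 δ-residue n≡1 refl ,
           at α 2 α-residue n≡1 refl , at γ 2 γ-residue n≡1 refl) ,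
  (λ n≡3 → at α 2 α-residue n≡3 refl , at γ 2 γ-residue n≡3 refl ,
           at β 0 β-residue n≡3 refl , at δ 0 δ-residue n≡3 refl)
  where
  at : ∀ A c → (∀ k → InV ((2 * k + suc c) % 4) (A k)) →
       ∀ {r} → n % 4 ≡ r → r % 2 ≡ 1 → InV ((r + c % 4) % 4) (A (n / 2))
  at A c h = InV-at-odd A c h n
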